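{- Let $G$ be a connected graph (loops and parallel edges allowed) with an injective weight function $\omega:E(G)\to\mathbb{R}$, and let $T$ be a spanning tree of $G$. Suppose $E(G)$ is partitioned into $E_1$ and $E_2$ such that $\omega(e_1)<\omega(e_2)$ for all $e_1\in E_1$, $e_2\in E_2$. Let $S\subsetneq V(G)$ be a set of vertices that are isolated in $G\langle E_2\rangle$, let $G_1=G\langle E_1\rangle$, $G_2^S=G\langle E_2\rangle-S$ and $F^S=T\langle E(T)\cap E_2\rangle-S$. Then $$ea_{\omega,G}(T)=ea_{\omega,G_1\bullet F^S}(T\bullet F^S)+ea_{\omega,G_2^S}(F^S).$$
   Context: For a graph $G$ and $E'\subseteq E(G)$, $G\langle E'\rangle$ denotes the spanning subgraph of $G$ with edge set $E'$; for $S\subsetneq V(G)$, $G-S$ is obtained by deleting the vertices in $S$ and all edges incident with them. For a forest $F$ that is a subgraph of a graph $G$ with injective weight function $\omega$ on $E(G)$, an edge $e\in E(G)\setminus E(F)$ is externally active with respect to $(\omega,F)$ if $F\cup e$ contains a cycle $C$ and $\omega(e)<\omega(e')$ for all $e'\in E(C)\setminus\{e\}$; $ea_{\omega,G}(F)$ is the number of such edges. For graphs $G$ and $F$ with $V(F)\subseteq V(G)$, $G\bullet F$ denotes the graph obtained from $G$ by deleting all edges in $E(F)\cap E(G)$ and, for each component $F_j$ of $F$, identifying all vertices of $F_j$ into a single vertex (vertices of $G$ not in $F$ are unchanged; edges keep their identities and weights). -}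

module Defs where

open import Level using (Level; _⊔_) renaming (zero to lzero)
open import Data.Nat using (ℕ; zero; suc; _+_)
open import Data.Fin using (Fin; zero; suc; inject₁; fromℕ)
open import Data.Fin.Subset using (Subset; _∈_; _∉_; ∣_∣)
open import Data.Product using (Σ; _×_; _,_; proj₁; proj₂)
open import Data.Sum using (_⊎_)
open import Data.Unit using (⊤)
open import Relation.Nullary using (¬_)
open import Relation.Binary.PropositionalEquality using (_≡_; _≢_)
open import Relation.Binary.Bundles using (StrictTotalOrder)

-- A finite multigraph (loops and parallel edges allowed) with vertex set
-- Fin n and edge set Fin m is given by its endpoint map
--   ends : Fin m → Fin n × Fin n.
-- Derived graphs (spanning subgraphs, vertex deletions, contractions) keep
-- the edge identities of G; they are described by an edge predicate
-- (Fin m → Set) and a vertex relation R (vertices are identified up to R,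
-- which is how the quotient in a contraction G • F is represented).

Ends : ℕ → ℕ → Set
Ends n m = Fin m → Fin n × Fin n

EdgeSet : ℕ → Set₁
EdgeSet m = Fin m → Set

VRel : ℕ → Set₁
VRel n = Fin n → Fin n → Set

Joins : ∀ {n m} → Ends n m → VRel n → Fin m → Fin n → Fin n → Set
Joins ends R e u v =
  (R (proj₁ (ends e)) u × R (proj₂ (ends e)) v) ⊎
  (R (proj₁ (ends e)) v × R (proj₂ (ends e)) u)

data Path {n m : ℕ} (ends : Ends n m) (X : EdgeSet m) : Fin n → Fin n → Set where
  here : ∀ {u} → Path ends X u u
  step : ∀ {u w v} (e : Fin m) → X e → Joins ends _≡_ e u w →
         Path ends X w v → Path ends X u v

-- A cycle of length suc k in the graph with edge set X, vertices taken up
-- to R: vertices vs 0 … vs k pairwise distinct (mod R), edges es 0 … es k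
-- pairwise distinct, es i joins vs i and vs (i+1), es k joins vs k and vs 0.
-- (Length 1 = loop, length 2 = pair of parallel edges.)
record Cycle {n m : ℕ} (ends : Ends n m) (R : VRel n) (X : EdgeSet m) : Set where
  field
    len   : ℕ
    vs    : Fin (suc len) → Fin n
    es    : Fin (suc len) → Fin m
    vs-distinct : ∀ i j → R (vs i) (vs j) → i ≡ j
    es-distinct : ∀ i j → es i ≡ es j → i ≡ j
    es-in : ∀ i → X (es i)
    es-join : ∀ (i : Fin len) → Joins ends R (es (inject₁ i)) (vs (inject₁ i)) (vs (suc i))
    es-close : Joins ends R (es (fromℕ len)) (vs (fromℕ len)) (vs zero)

open Cycle public

module _ {c ℓ₁ ℓ₂ : Level} (O : StrictTotalOrder c ℓ₁ ℓ₂) where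
  open StrictTotalOrder O renaming (Carrier to W)

  ExtActive : ∀ {n m} → Ends n m → (Fin m → W) → VRel n →
              EdgeSet m → EdgeSet m → Fin m → Set ℓ₂
  ExtActive ends ω R H F e =
    H e × ¬ F e ×
    Σ (Cycle ends R (λ x → F x ⊎ x ≡ e))
      (λ C → ∀ i → es C i ≢ e → ω e < ω (es C i))

  -- A is exactly the set of externally active edges, so ea_{ω,H}(F) = ∣ A ∣.
  IsEASet : ∀ {n m} → Ends n m → (Fin m → W) → VRel n →
            EdgeSet m → EdgeSet m → Subset m → Set ℓ₂
  IsEASet ends ω R H F A =
    ∀ e → (e ∈ A → ExtActive ends ω R H F e) × (ExtActive ends ω R H F e → e ∈ A)

AllEdges : ∀ {m} → EdgeSet m
AllEdges _ = ⊤

⟦_⟧ : ∀ {m} → Subset m → EdgeSet m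
⟦ X ⟧ e = e ∈ X

Connected : ∀ {n m} → Ends n m → EdgeSet m → Set
Connected ends X = ∀ u v → Path ends X u v

IsSpanningTree : ∀ {n m} → Ends n m → Subset m → Set
IsSpanningTree ends T = Connected ends ⟦ T ⟧ × ¬ Cycle ends _≡_ ⟦ T ⟧

Avoids : ∀ {n m} → Ends n m → Subset n → Fin m → Set
Avoids ends S e = proj₁ (ends e) ∉ S × proj₂ (ends e) ∉ S

DelVerts : ∀ {n m} → Ends n m → EdgeSet m → Subset n → EdgeSet m
DelVerts ends X S e = X e × Avoids ends S e

ContrEdges : ∀ {m} → EdgeSet m → EdgeSet m → EdgeSet m
ContrEdges X F e = X e × ¬ F e

ContrRel : ∀ {n m} → Ends n m → EdgeSet m → VRel n
ContrRel ends F = Path ends F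

module Submission where

-- Call a path between the ends of an edge e "heavy" if it uses
-- only edges of T heavier than e.  Since T is acyclic, e is externally
-- active in G iff e ∉ T and its ends are joined by a heavy path: the other
-- edges of an active cycle form such a path, and conversely a heavy path
-- closes up with e to a cycle.  The same holds in G₁ • Fˢ for e ∈ E₁ (the
-- edges of Fˢ are all heavier than e, so contracting them does not change
-- which heavy paths exist, and contraction keeps T ∖ Fˢ acyclic), while for
-- e ∈ E₂ every edge of an active cycle lies in E₂, hence avoids S, so e is
-- active in G₂ˢ iff it is active in G.  Thus the active set of G is the
-- disjoint union of those of G₁ • Fˢ and G₂ˢ, and the counts add up.

open import Defs
open import Level using (Level)
open import Data.Nat using (ℕ; zero; suc; _+_; _≤_; _<_; z≤n; s≤s)
open import Data.Nat.Properties using (<⇒≤; <-irrefl; +-suc)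
open import Data.Fin using (Fin; zero; suc; inject₁; fromℕ; toℕ; _≟_)
open import Data.Fin.Properties
  using (any?; injective⇒≤; fromℕ≢inject₁; inject₁-injective; toℕ-inject₁)
open import Data.Fin.Relation.Unary.Top using (view; ‵fromℕ; ‵inject₁)
open import Data.Fin.Subset using (Subset; _∈_; _∉_; ∣_∣; _∪_; inside; outside)
open import Data.Fin.Subset.Properties using (_∈?_; x∈p∪q⁺; x∈p∪q⁻; ⊆-antisym)
open import Data.Vec using (_∷_; []; here; there)
open import Data.Product using (Σ; _×_; _,_; proj₁; proj₂)
open import Data.Sum using (_⊎_; inj₁; inj₂; map₁)
open import Data.Empty using (⊥; ⊥-elim)
open import Data.Unit using (⊤; tt)
open import Function.Bundles using (_⇔_; mk⇔; Equivalence)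
open import Relation.Nullary using (¬_; Dec; yes; no)
open import Relation.Nullary.Decidable using (_×-dec_; _⊎-dec_; ¬?; True; toWitness; fromWitness)
open import Relation.Binary using (IsEquivalence; Decidable)
open import Relation.Binary.Bundles using (StrictTotalOrder)
open import Relation.Binary.PropositionalEquality
  using (_≡_; _≢_; refl; sym; trans; cong; subst; module ≡-Reasoning)
  renaming (isEquivalence to ≡-isEquivalence)

swapJoins : ∀ {n m} {ends : Ends n m} {R : VRel n} {x u v} →
            Joins ends R x u v → Joins ends R x v u
swapJoins (inj₁ p) = inj₂ p
swapJoins (inj₂ p) = inj₁ p

mapCycle : ∀ {n m} {ends : Ends n m} {R : VRel n} {X Y : EdgeSet m} →
           (C : Cycle ends R X) → (∀ i → Y (es C i)) → Cycle ends R Y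
mapCycle C inY = record
  { len = len C ; vs = vs C ; es = es C ; vs-distinct = vs-distinct C
  ; es-distinct = es-distinct C ; es-in = inY ; es-join = es-join C ; es-close = es-close C }

module Paths {n m : ℕ} (ends : Ends n m) where

  infixr 5 _++ₚ_
  _++ₚ_ : ∀ {X u v w} → Path ends X u v → Path ends X v w → Path ends X u w
  here ++ₚ q = q
  step x x∈X j p ++ₚ q = step x x∈X j (p ++ₚ q)

  reverseₚ : ∀ {X u v} → Path ends X u v → Path ends X v u
  reverseₚ here = here
  reverseₚ (step x x∈X j p) = reverseₚ p ++ₚ step x x∈X (swapJoins {ends = ends} {R = _≡_} j) here

  mapₚ : ∀ {X Y : EdgeSet m} {u v} → (∀ x → X x → Y x) → Path ends X u v → Path ends Y u v
  mapₚ f here = here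
  mapₚ f (step x x∈X j p) = step x (f x x∈X) j (mapₚ f p)

  ≡⇒path : ∀ {X u v} → u ≡ v → Path ends X u v
  ≡⇒path refl = here

  connected-isEquivalence : ∀ {X} → IsEquivalence (Path ends X)
  connected-isEquivalence = record { refl = here ; sym = reverseₚ ; trans = _++ₚ_ }

  EndsJoined : EdgeSet m → Fin m → Set
  EndsJoined Y x = Path ends Y (proj₁ (ends x)) (proj₂ (ends x))

-- Walks in which consecutive vertices are only determined up to an
-- equivalence R (R = _≡_ for G itself, R = "same component of F" for a
-- contraction G • F).
module Walks {n m : ℕ} (ends : Ends n m) {R : VRel n}
             (R-equiv : IsEquivalence R) (R? : Decidable R) where
  open IsEquivalence R-equiv renaming (refl to R-refl; sym to R-sym; trans to R-trans)

  data Walk (X : EdgeSet m) : Fin n → Fin n → Set where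
    end  : ∀ {u v} → R u v → Walk X u v
    step : ∀ {u w v} (x : Fin m) → X x → Joins ends R x u w → Walk X w v → Walk X u v

  steps : ∀ {X u v} → Walk X u v → ℕ
  steps (end _) = 0
  steps (step _ _ _ p) = suc (steps p)

  vertexAt : ∀ {X u v} (p : Walk X u v) → Fin (suc (steps p)) → Fin n
  vertexAt {u = u} p zero = u
  vertexAt (step _ _ _ p) (suc i) = vertexAt p i

  joins-respˡ : ∀ {x u u' w} → R u u' → Joins ends R x u w → Joins ends R x u' w
  joins-respˡ r (inj₁ (a , b)) = inj₁ (R-trans a r , b)
  joins-respˡ r (inj₂ (a , b)) = inj₂ (a , R-trans b r)

  joins-≡⇒R : ∀ {x u w} → Joins ends _≡_ x u w → Joins ends R x u w
  joins-≡⇒R (inj₁ (refl , refl)) = inj₁ (R-refl , R-refl)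
  joins-≡⇒R (inj₂ (refl , refl)) = inj₂ (R-refl , R-refl)

  joins-shared : ∀ {x u w c d} → Joins ends R x u w → Joins ends R x c d → R u c ⊎ R u d
  joins-shared (inj₁ (a , _)) (inj₁ (b , _)) = inj₁ (R-trans (R-sym a) b)
  joins-shared (inj₁ (a , _)) (inj₂ (b , _)) = inj₂ (R-trans (R-sym a) b)
  joins-shared (inj₂ (_ , a)) (inj₁ (_ , b)) = inj₂ (R-trans (R-sym a) b)
  joins-shared (inj₂ (_ , a)) (inj₂ (_ , b)) = inj₁ (R-trans (R-sym a) b)

  restart : ∀ {X a u v} → R a u → Walk X u v → Walk X a v
  restart r (end r') = end (R-trans r r')
  restart r (step x x∈X j p) = step x x∈X (joins-respˡ (R-sym r) j) p

  fromPath : ∀ {X a b} → Path ends X a b → Walk X a b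
  fromPath here = end R-refl
  fromPath (step x x∈X j p) = step x x∈X (joins-≡⇒R j) (fromPath p)

  Simple : ∀ {X u v} → Walk X u v → Set
  Simple (end _) = ⊤
  Simple {u = u} (step _ _ _ p) = (∀ i → ¬ R u (vertexAt p i)) × Simple p

  vertexAt-injective : ∀ {X u v} (p : Walk X u v) → Simple p →
                       ∀ i j → R (vertexAt p i) (vertexAt p j) → i ≡ j
  vertexAt-injective p s zero zero r = refl
  vertexAt-injective (step _ _ _ p) (new , s) zero (suc j) r = ⊥-elim (new j r)
  vertexAt-injective (step _ _ _ p) (new , s) (suc i) zero r = ⊥-elim (new i (R-sym r))
  vertexAt-injective (step _ _ _ p) (new , s) (suc i) (suc j) r =
    cong suc (vertexAt-injective p s i j r)

  shortcut : ∀ {X u w v} (q : Walk X w v) → Simple q → (i : Fin (suc (steps q))) →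
             R u (vertexAt q i) → Σ (Walk X u v) Simple
  shortcut (end r') _ zero r = end (R-trans r r') , tt
  shortcut (step y y∈X j q) (new , s) zero r =
    step y y∈X (joins-respˡ (R-sym r) j) q , (λ i r' → new i (R-trans (R-sym r) r')) , s
  shortcut (step _ _ _ q) (_ , s) (suc i) r = shortcut q s i r

  simplify : ∀ {X u v} → Walk X u v → Σ (Walk X u v) Simple
  simplify (end r) = end r , tt
  simplify {u = u} (step x x∈X j p) with simplify p
  ... | q , s with any? (λ i → R? u (vertexAt q i))
  ... | yes (i , r) = shortcut q s i r
  ... | no fresh = step x x∈X j q , (λ i r → fresh (i , r)) , s

  module Closing {X : EdgeSet m} (e : Fin m) (e∉X : ¬ X e) where

    closedEdges : ∀ {u v} (p : Walk X u v) → Fin (suc (steps p)) → Fin m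
    closedEdges (end _) zero = e
    closedEdges (step x _ _ _) zero = x
    closedEdges (step _ _ _ p) (suc i) = closedEdges p i

    closedEdges-in : ∀ {u v} (p : Walk X u v) i → X (closedEdges p i) ⊎ closedEdges p i ≡ e
    closedEdges-in (end _) zero = inj₂ refl
    closedEdges-in (step x x∈X _ _) zero = inj₁ x∈X
    closedEdges-in (step _ _ _ p) (suc i) = closedEdges-in p i

    closedEdges-joins : ∀ {w v} (q : Walk X w v) j → closedEdges q j ≡ e ⊎
      Σ (Fin (suc (steps q))) λ a → Σ (Fin (suc (steps q))) λ b →
        Joins ends R (closedEdges q j) (vertexAt q a) (vertexAt q b)
    closedEdges-joins (end _) zero = inj₁ refl
    closedEdges-joins (step _ _ j _) zero = inj₂ (zero , suc zero , j)
    closedEdges-joins (step _ _ _ q) (suc i) with closedEdges-joins q i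
    ... | inj₁ eq = inj₁ eq
    ... | inj₂ (a , b , j) = inj₂ (suc a , suc b , j)

    -- the first edge of a simple walk is not used again: otherwise it would
    -- touch its start vertex u a second time
    first-edge-fresh : ∀ {x u w v} → X x → Joins ends R x u w → (q : Walk X w v) →
                       (∀ i → ¬ R u (vertexAt q i)) → ∀ j → x ≢ closedEdges q j
    first-edge-fresh x∈X jx q new j eq with closedEdges-joins q j
    ... | inj₁ eq' = e∉X (subst X (trans eq eq') x∈X)
    ... | inj₂ (a , b , jq) with joins-shared jx (subst (λ y → Joins ends R y _ _) (sym eq) jq)
    ...   | inj₁ r = new a r
    ...   | inj₂ r = new b r

    closedEdges-injective : ∀ {u v} (p : Walk X u v) → Simple p →
                            ∀ i j → closedEdges p i ≡ closedEdges p j → i ≡ j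
    closedEdges-injective p _ zero zero _ = refl
    closedEdges-injective (step _ x∈X jx q) (new , _) zero (suc j) eq =
      ⊥-elim (first-edge-fresh x∈X jx q new j eq)
    closedEdges-injective (step _ x∈X jx q) (new , _) (suc i) zero eq =
      ⊥-elim (first-edge-fresh x∈X jx q new i (sym eq))
    closedEdges-injective (step _ _ _ q) (_ , s) (suc i) (suc j) eq =
      cong suc (closedEdges-injective q s i j eq)

    closedEdges-join : ∀ {u v} (p : Walk X u v) (i : Fin (steps p)) →
      Joins ends R (closedEdges p (inject₁ i)) (vertexAt p (inject₁ i)) (vertexAt p (suc i))
    closedEdges-join (step _ _ j _) zero = j
    closedEdges-join (step _ _ _ q) (suc i) = closedEdges-join q i

    closedEdges-close : ∀ {u v z} (p : Walk X u v) → Joins ends R e v z →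
      Joins ends R (closedEdges p (fromℕ (steps p))) (vertexAt p (fromℕ (steps p))) z
    closedEdges-close (end r) j = joins-respˡ (R-sym r) j
    closedEdges-close (step _ _ _ q) j = closedEdges-close q j

    closeSimpleWalk : ∀ {a b} (p : Walk X a b) → Simple p → Joins ends R e b a →
                      Cycle ends R (λ y → X y ⊎ y ≡ e)
    closeSimpleWalk p s j = record
      { len = steps p ; vs = vertexAt p ; es = closedEdges p
      ; vs-distinct = vertexAt-injective p s ; es-distinct = closedEdges-injective p s
      ; es-in = closedEdges-in p ; es-join = closedEdges-join p
      ; es-close = closedEdges-close p j }

  closeWalk : ∀ {X a b} (e : Fin m) → ¬ X e → Walk X a b → Joins ends R e b a →
              Cycle ends R (λ y → X y ⊎ y ≡ e)
  closeWalk e e∉X p j = Closing.closeSimpleWalk e e∉X (proj₁ s) (proj₂ s) j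
    where s = simplify p

module PlainWalks {n m : ℕ} (ends : Ends n m) where
  open Walks ends ≡-isEquivalence _≟_ public

  toPath : ∀ {X a b} → Walk X a b → Path ends X a b
  toPath (end refl) = here
  toPath (step x x∈X j p) = step x x∈X j (toPath p)

  pathCycle : ∀ {X} (x : Fin m) → ¬ X x → Paths.EndsJoined ends X x →
              Cycle ends _≡_ (λ y → X y ⊎ y ≡ x)
  pathCycle x x∉X p = closeWalk x x∉X (fromPath p) (inj₂ (refl , refl))

-- Connectivity in a finite graph with a decidable edge set is decidable:
-- a connecting walk can be taken simple, hence of at most n steps, and
-- walks of bounded length can be searched exhaustively.
module Connectivity {n m : ℕ} (ends : Ends n m) (X : EdgeSet m) (X? : ∀ x → Dec (X x)) where
  open PlainWalks ends

  joins? : ∀ x u w → Dec (Joins ends _≡_ x u w)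
  joins? x u w = ((proj₁ (ends x) ≟ u) ×-dec (proj₂ (ends x) ≟ w)) ⊎-dec
                 ((proj₁ (ends x) ≟ w) ×-dec (proj₂ (ends x) ≟ u))

  WalkWithin : ℕ → Fin n → Fin n → Set
  WalkWithin k u v = Σ (Walk X u v) (λ p → steps p ≤ k)

  walkWithin? : ∀ k u v → Dec (WalkWithin k u v)
  walkWithin? zero u v with u ≟ v
  ... | yes u≡v = yes (end u≡v , z≤n)
  ... | no u≢v = no λ { (end u≡v , _) → u≢v u≡v ; (step _ _ _ _ , ()) }
  walkWithin? (suc k) u v with u ≟ v
  ... | yes u≡v = yes (end u≡v , z≤n)
  ... | no u≢v with any? (λ x → any? (λ w → X? x ×-dec (joins? x u w ×-dec walkWithin? k w v)))
  ...   | yes (x , w , x∈X , j , p , p≤k) = yes (step x x∈X j p , s≤s p≤k)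
  ...   | no none = no λ { (end u≡v , _) → u≢v u≡v
                         ; (step x x∈X j p , s≤s p≤k) → none (x , _ , x∈X , j , p , p≤k) }

  -- pigeonhole: a simple walk visits steps p + 1 distinct vertices
  simple-steps≤n : ∀ {u v} (p : Walk X u v) → Simple p → steps p ≤ n
  simple-steps≤n p s = <⇒≤ (injective⇒≤ (λ {i} {j} → vertexAt-injective p s i j))

  connected? : ∀ u v → Dec (Path ends X u v)
  connected? u v with walkWithin? n u v
  ... | yes (p , _) = yes (toPath p)
  ... | no none = no λ path → let (q , s) = simplify (fromPath path) in
                              none (q , simple-steps≤n q s)

-- If
-- all edges of a cycle (taken modulo R) except its i-th one lie in W, then
-- going the other way round the cycle gives a W-path between the two ends
-- of that i-th edge.
module AroundCycle {n m : ℕ} (ends : Ends n m) {R : VRel n} (W : EdgeSet m)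
                   (R⇒path : ∀ {a b} → R a b → Path ends W a b) where
  open Paths ends

  edgePath : ∀ {x a b} → W x → Joins ends R x a b → Path ends W a b
  edgePath x∈W (inj₁ (r₁ , r₂)) =
    reverseₚ (R⇒path r₁) ++ₚ step _ x∈W (inj₁ (refl , refl)) (R⇒path r₂)
  edgePath x∈W (inj₂ (r₁ , r₂)) =
    reverseₚ (R⇒path r₂) ++ₚ step _ x∈W (inj₂ (refl , refl)) (R⇒path r₁)

  closePath : ∀ {x a b} → Joins ends R x a b → Path ends W b a → EndsJoined W x
  closePath (inj₁ (r₁ , r₂)) p = R⇒path r₁ ++ₚ reverseₚ p ++ₚ reverseₚ (R⇒path r₂)
  closePath (inj₂ (r₁ , r₂)) p = R⇒path r₁ ++ₚ p ++ₚ reverseₚ (R⇒path r₂)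

  prefix : ∀ {L} (vs : Fin (suc L) → Fin n) (es : Fin (suc L) → Fin m) →
    (∀ (k : Fin L) → Joins ends R (es (inject₁ k)) (vs (inject₁ k)) (vs (suc k))) →
    (a : Fin (suc L)) → (∀ (k : Fin L) → toℕ k < toℕ a → W (es (inject₁ k))) →
    Path ends W (vs zero) (vs a)
  prefix vs es join zero inW = here
  prefix {suc L} vs es join (suc a) inW =
    edgePath (inW zero (s≤s z≤n)) (join zero) ++ₚ
    prefix (λ i → vs (suc i)) (λ i → es (suc i)) (λ k → join (suc k)) a
           (λ k k<a → inW (suc k) (s≤s k<a))

  suffix : ∀ {L} (vs : Fin (suc L) → Fin n) (es : Fin (suc L) → Fin m) →
    (∀ (k : Fin L) → Joins ends R (es (inject₁ k)) (vs (inject₁ k)) (vs (suc k))) →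
    (a : Fin (suc L)) → (∀ (k : Fin L) → toℕ a ≤ toℕ k → W (es (inject₁ k))) →
    Path ends W (vs a) (vs (fromℕ L))
  suffix {L} vs es join zero inW = prefix vs es join (fromℕ L) (λ k _ → inW k z≤n)
  suffix {suc L} vs es join (suc a) inW =
    suffix (λ i → vs (suc i)) (λ i → es (suc i)) (λ k → join (suc k)) a
           (λ k a≤k → inW (suc k) (s≤s a≤k))

  walkAround : ∀ {Y} (C : Cycle ends R Y) (i : Fin (suc (len C))) →
    (∀ j → j ≢ i → W (es C j)) → EndsJoined W (es C i)
  walkAround C i others with view i
  ... | ‵fromℕ =
    closePath (es-close C)
      (prefix (vs C) (es C) (es-join C) (fromℕ (len C))
              (λ k _ → others (inject₁ k) (λ eq → fromℕ≢inject₁ (sym eq))))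
  ... | ‵inject₁ i' =
    closePath (es-join C i')
      (suffix (vs C) (es C) (es-join C) (suc i') after ++ₚ
       edgePath (others (fromℕ (len C)) fromℕ≢inject₁) (es-close C) ++ₚ
       prefix (vs C) (es C) (es-join C) (inject₁ i') before)
    where
    after : ∀ k → suc (toℕ i') ≤ toℕ k → W (es C (inject₁ k))
    after k i'<k = others (inject₁ k) λ eq → <-irrefl (cong toℕ (inject₁-injective (sym eq))) i'<k
    before : ∀ k → toℕ k < toℕ (inject₁ i') → W (es C (inject₁ k))
    before k k<i' = others (inject₁ k) λ eq →
      <-irrefl (trans (cong toℕ (inject₁-injective eq)) (sym (toℕ-inject₁ i'))) k<i'

module Contraction {n m : ℕ} (ends : Ends n m) (F : EdgeSet m) (F? : ∀ x → Dec (F x)) where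
  open Paths ends
  open Walks ends (connected-isEquivalence {X = F}) (Connectivity.connected? ends F F?) public

  contractPath : ∀ {X Y : EdgeSet m} {a b} → (∀ x → X x → ¬ F x → Y x) →
                 Path ends X a b → Walk Y a b
  contractPath keep here = end here
  contractPath keep (step x x∈X j p) with F? x
  ... | yes x∈F = restart (step x x∈F j here) (contractPath keep p)
  ... | no x∉F = step x (keep x x∈X x∉F) (joins-≡⇒R j) (contractPath keep p)

  -- Contracting part F of an acyclic edge set T leaves T ∖ F acyclic: a
  -- cycle of T ∖ F in G • F, with the F-paths between its identified
  -- vertices filled back in, would give a cycle of T through its first edge.
  contraction-acyclic : (T : EdgeSet m) → (∀ x → F x → T x) →
                        ¬ Cycle ends _≡_ T → ¬ Cycle ends (ContrRel ends F) (ContrEdges T F)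
  contraction-acyclic T F⊆T acyclic C = acyclic (mapCycle C₀ inT)
    where
    x : Fin m
    x = es C zero
    x∈T∖F : ContrEdges T F x
    x∈T∖F = es-in C zero
    T-x : EdgeSet m
    T-x y = T y × y ≢ x
    F⇒T-x : ∀ y → F y → T-x y
    F⇒T-x y y∈F = F⊆T y y∈F , λ y≡x → proj₂ x∈T∖F (subst F y≡x y∈F)
    others : ∀ j → j ≢ zero → T-x (es C j)
    others j j≢0 = proj₁ (es-in C j) , λ eq → j≢0 (es-distinct C j zero eq)
    C₀ : Cycle ends _≡_ (λ y → T-x y ⊎ y ≡ x)
    C₀ = PlainWalks.pathCycle ends x (λ x∈T-x → proj₂ x∈T-x refl)
           (AroundCycle.walkAround ends T-x (mapₚ F⇒T-x) C zero others)
    inT : ∀ i → T (es C₀ i)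
    inT i with es-in C₀ i
    ... | inj₁ y∈T-x = proj₁ y∈T-x
    ... | inj₂ y≡x = subst T (sym y≡x) (proj₁ x∈T∖F)

Disjoint : ∀ {m} → Subset m → Subset m → Set
Disjoint p q = ∀ {x} → x ∈ p → x ∈ q → ⊥

disjoint-tail : ∀ {m s t} {p q : Subset m} → Disjoint (s ∷ p) (t ∷ q) → Disjoint p q
disjoint-tail disj x∈p x∈q = disj (there x∈p) (there x∈q)

∣p∪q∣≡∣p∣+∣q∣ : ∀ {m} (p q : Subset m) → Disjoint p q → ∣ p ∪ q ∣ ≡ ∣ p ∣ + ∣ q ∣
∣p∪q∣≡∣p∣+∣q∣ [] [] _ = refl
∣p∪q∣≡∣p∣+∣q∣ (inside ∷ p) (inside ∷ q) disj = ⊥-elim (disj here here)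
∣p∪q∣≡∣p∣+∣q∣ (inside ∷ p) (outside ∷ q) disj =
  cong suc (∣p∪q∣≡∣p∣+∣q∣ p q (disjoint-tail disj))
∣p∪q∣≡∣p∣+∣q∣ (outside ∷ p) (inside ∷ q) disj =
  trans (cong suc (∣p∪q∣≡∣p∣+∣q∣ p q (disjoint-tail disj))) (sym (+-suc ∣ p ∣ ∣ q ∣))
∣p∪q∣≡∣p∣+∣q∣ (outside ∷ p) (outside ∷ q) disj = ∣p∪q∣≡∣p∣+∣q∣ p q (disjoint-tail disj)

module Weighted {c ℓ₁ ℓ₂ : Level} (O : StrictTotalOrder c ℓ₁ ℓ₂) {n m : ℕ}
                (ends : Ends n m) (ω : Fin m → StrictTotalOrder.Carrier O) where
  open StrictTotalOrder O using (_<?_; irrefl; module Eq) renaming (_<_ to _<ₒ_)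
  open Paths ends

  -- the edges of X strictly heavier than e (the comparison is stored as a
  -- decided, hence small, proposition so that this is again an edge set)
  Heavier : Fin m → EdgeSet m → EdgeSet m
  Heavier e X x = X x × True (ω e <? ω x)

  not-heavier-than-itself : ∀ {X} e → ¬ Heavier e X e
  not-heavier-than-itself e (_ , e<e) = irrefl Eq.refl (toWitness e<e)

  HeavyPath : EdgeSet m → Fin m → Set
  HeavyPath X e = EndsJoined (Heavier e X) e

  ActiveCycle : VRel n → EdgeSet m → Fin m → Set ℓ₂
  ActiveCycle R X e =
    Σ (Cycle ends R (λ y → X y ⊎ y ≡ e)) (λ C → ∀ i → es C i ≢ e → ω e <ₒ ω (es C i))

  activeCycle⇒heavyPath : ∀ {R X W e} → (∀ x → X x → W x) →
    (∀ {a b} → R a b → Path ends (Heavier e W) a b) → ¬ Cycle ends R X →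
    ActiveCycle R X e → HeavyPath W e
  activeCycle⇒heavyPath {R} {X} {W} {e} X⊆W R⇒path acyclic (C , heavier)
    with any? (λ i → es C i ≟ e)
  ... | no e∉C = ⊥-elim (acyclic (mapCycle C inX))
    where
    inX : ∀ i → X (es C i)
    inX i with es-in C i
    ... | inj₁ x∈X = x∈X
    ... | inj₂ eq = ⊥-elim (e∉C (i , eq))
  ... | yes (i , Cᵢ≡e) = subst (EndsJoined (Heavier e W)) Cᵢ≡e
                           (AroundCycle.walkAround ends (Heavier e W) R⇒path C i others)
    where
    Cⱼ≢e : ∀ j → j ≢ i → es C j ≢ e
    Cⱼ≢e j j≢i Cⱼ≡e = j≢i (es-distinct C j i (trans Cⱼ≡e (sym Cᵢ≡e)))
    others : ∀ j → j ≢ i → Heavier e W (es C j)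
    others j j≢i with es-in C j
    ... | inj₂ Cⱼ≡e = ⊥-elim (Cⱼ≢e j j≢i Cⱼ≡e)
    ... | inj₁ x∈X = X⊆W _ x∈X , fromWitness (heavier j (Cⱼ≢e j j≢i))

  heavyWalk⇒activeCycle : ∀ {R : VRel n} {X e} (R-equiv : IsEquivalence R) (R? : Decidable R) →
    Walks.Walk ends R-equiv R? (Heavier e X) (proj₁ (ends e)) (proj₂ (ends e)) →
    ActiveCycle R X e
  heavyWalk⇒activeCycle {R} {X} {e} R-equiv R? p = mapCycle C inX , heavier
    where
    open IsEquivalence R-equiv using () renaming (refl to R-refl)
    C : Cycle ends R (λ y → Heavier e X y ⊎ y ≡ e)
    C = Walks.closeWalk ends R-equiv R? e (not-heavier-than-itself {X} e) p (inj₂ (R-refl , R-refl))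
    inX : ∀ i → X (es C i) ⊎ es C i ≡ e
    inX i = map₁ proj₁ (es-in C i)
    heavier : ∀ i → es C i ≢ e → ω e <ₒ ω (es C i)
    heavier i Cᵢ≢e with es-in C i
    ... | inj₁ (_ , e<Cᵢ) = toWitness e<Cᵢ
    ... | inj₂ Cᵢ≡e = ⊥-elim (Cᵢ≢e Cᵢ≡e)

-- The setting of the corollary.
module Corollary {c ℓ₁ ℓ₂ : Level} (O : StrictTotalOrder c ℓ₁ ℓ₂) {n m : ℕ}
    (ends : Ends n m) (ω : Fin m → StrictTotalOrder.Carrier O)
    (T : Subset m) (acyclic : ¬ Cycle ends _≡_ ⟦ T ⟧)
    (E₁ E₂ : Subset m) (cover : ∀ e → e ∈ E₁ ⊎ e ∈ E₂) (disjoint : ∀ e → e ∈ E₁ → e ∈ E₂ → ⊥)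
    (E₁<E₂ : ∀ e₁ e₂ → e₁ ∈ E₁ → e₂ ∈ E₂ → StrictTotalOrder._<_ O (ω e₁) (ω e₂))
    (S : Subset n)
    (isolated₁ : ∀ v → v ∈ S → ∀ e → e ∈ E₂ → proj₁ (ends e) ≡ v → ⊥)
    (isolated₂ : ∀ v → v ∈ S → ∀ e → e ∈ E₂ → proj₂ (ends e) ≡ v → ⊥) where

  open StrictTotalOrder O using (irrefl; module Eq) renaming (_<_ to _<ₒ_; trans to <-trans)
  open Weighted O ends ω
  open Paths ends

  FS G₂S : EdgeSet m
  FS = DelVerts ends (λ e → e ∈ T × e ∈ E₂) S
  G₂S = DelVerts ends ⟦ E₂ ⟧ S

  FS? : ∀ x → Dec (FS x)
  FS? x = ((x ∈? T) ×-dec (x ∈? E₂)) ×-dec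
          (¬? (proj₁ (ends x) ∈? S) ×-dec ¬? (proj₂ (ends x) ∈? S))

  module G•FS = Contraction ends FS FS?

  ActiveInG ActiveInG₁•FS ActiveInG₂S : Fin m → Set ℓ₂
  ActiveInG = ExtActive O ends ω _≡_ AllEdges ⟦ T ⟧
  ActiveInG₁•FS = ExtActive O ends ω (ContrRel ends FS) (ContrEdges ⟦ E₁ ⟧ FS) (ContrEdges ⟦ T ⟧ FS)
  ActiveInG₂S = ExtActive O ends ω _≡_ G₂S FS

  E₂-avoids-S : ∀ e → e ∈ E₂ → Avoids ends S e
  E₂-avoids-S e e∈E₂ = (λ s → isolated₁ _ s e e∈E₂ refl) , (λ s → isolated₂ _ s e e∈E₂ refl)

  heavier-than-E₂ : ∀ e y → e ∈ E₂ → ω e <ₒ ω y → y ∈ E₂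
  heavier-than-E₂ e y e∈E₂ e<y with cover y
  ... | inj₂ y∈E₂ = y∈E₂
  ... | inj₁ y∈E₁ = ⊥-elim (irrefl Eq.refl (<-trans (E₁<E₂ y e y∈E₁ e∈E₂) e<y))

  FS-heavier-than-E₁ : ∀ e → e ∈ E₁ → ∀ y → FS y → Heavier e ⟦ T ⟧ y
  FS-heavier-than-E₁ e e∈E₁ y ((y∈T , y∈E₂) , _) = y∈T , fromWitness (E₁<E₂ e y e∈E₁ y∈E₂)

  activeInG⇔ : ∀ e → ActiveInG e ⇔ (e ∉ T × HeavyPath ⟦ T ⟧ e)
  activeInG⇔ e = mk⇔
    (λ { (_ , e∉T , active) →
         e∉T , activeCycle⇒heavyPath (λ _ x∈T → x∈T) ≡⇒path acyclic active })
    (λ { (e∉T , path) →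
         tt , e∉T , heavyWalk⇒activeCycle ≡-isEquivalence _≟_ (PlainWalks.fromPath ends path) })

  activeInG₁•FS⇔ : ∀ e → ActiveInG₁•FS e ⇔ (e ∈ E₁ × e ∉ T × HeavyPath ⟦ T ⟧ e)
  activeInG₁•FS⇔ e = mk⇔
    (λ { ((e∈E₁ , e∉FS) , e∉T∖FS , active) →
         e∈E₁ , (λ e∈T → e∉T∖FS (e∈T , e∉FS)) ,
         activeCycle⇒heavyPath (λ _ x∈T∖FS → proj₁ x∈T∖FS) (mapₚ (FS-heavier-than-E₁ e e∈E₁))
           (G•FS.contraction-acyclic ⟦ T ⟧ (λ _ x∈FS → proj₁ (proj₁ x∈FS)) acyclic) active })
    (λ { (e∈E₁ , e∉T , path) →
         (e∈E₁ , (λ e∈FS → disjoint e e∈E₁ (proj₂ (proj₁ e∈FS)))) ,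
         (λ e∈T∖FS → e∉T (proj₁ e∈T∖FS)) ,
         heavyWalk⇒activeCycle connected-isEquivalence (Connectivity.connected? ends FS FS?)
           (G•FS.contractPath (λ x (x∈T , heavier) x∉FS → (x∈T , x∉FS) , heavier) path) })

  -- e is active in G₂ˢ iff e ∈ E₂ and e is active in G: all edges of an
  -- active cycle of an E₂-edge are in E₂, hence avoid S
  activeInG₂S⇔ : ∀ e → ActiveInG₂S e ⇔ (e ∈ E₂ × ActiveInG e)
  activeInG₂S⇔ e = mk⇔
    (λ { ((e∈E₂ , _) , e∉FS , C , heavier) →
         e∈E₂ , tt , (λ e∈T → e∉FS ((e∈T , e∈E₂) , E₂-avoids-S e e∈E₂)) ,
         mapCycle C (λ i → map₁ (λ x∈FS → proj₁ (proj₁ x∈FS)) (es-in C i)) , heavier })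
    (λ { (e∈E₂ , _ , e∉T , C , heavier) →
         (e∈E₂ , E₂-avoids-S e e∈E₂) , (λ e∈FS → e∉T (proj₁ (proj₁ e∈FS))) ,
         mapCycle C (inFS e∉T e∈E₂ C heavier) , heavier })
    where
    inFS : e ∉ T → e ∈ E₂ → (C : Cycle ends _≡_ (λ y → y ∈ T ⊎ y ≡ e)) →
           (∀ i → es C i ≢ e → ω e <ₒ ω (es C i)) → ∀ i → FS (es C i) ⊎ es C i ≡ e
    inFS e∉T e∈E₂ C heavier i with es-in C i
    ... | inj₂ Cᵢ≡e = inj₂ Cᵢ≡e
    ... | inj₁ Cᵢ∈T = inj₁ ((Cᵢ∈T , Cᵢ∈E₂) , E₂-avoids-S _ Cᵢ∈E₂)
      where
      Cᵢ≢e : es C i ≢ e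
      Cᵢ≢e Cᵢ≡e = e∉T (subst (_∈ T) Cᵢ≡e Cᵢ∈T)
      Cᵢ∈E₂ : es C i ∈ E₂
      Cᵢ∈E₂ = heavier-than-E₂ e (es C i) e∈E₂ (heavier i Cᵢ≢e)

  module _ (A B C : Subset m)
           (isA : IsEASet O ends ω _≡_ AllEdges ⟦ T ⟧ A)
           (isB : IsEASet O ends ω (ContrRel ends FS) (ContrEdges ⟦ E₁ ⟧ FS) (ContrEdges ⟦ T ⟧ FS) B)
           (isC : IsEASet O ends ω _≡_ G₂S FS C) where
    open Equivalence using (to; from)

    A≡B∪C : A ≡ B ∪ C
    A≡B∪C = ⊆-antisym A⊆B∪C B∪C⊆A
      where
      A⊆B∪C : ∀ {e} → e ∈ A → e ∈ B ∪ C
      A⊆B∪C {e} e∈A with cover e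
      ... | inj₁ e∈E₁ = x∈p∪q⁺ (inj₁ (proj₂ (isB e)
                          (from (activeInG₁•FS⇔ e) (e∈E₁ , to (activeInG⇔ e) (proj₁ (isA e) e∈A)))))
      ... | inj₂ e∈E₂ = x∈p∪q⁺ (inj₂ (proj₂ (isC e)
                          (from (activeInG₂S⇔ e) (e∈E₂ , proj₁ (isA e) e∈A))))
      B∪C⊆A : ∀ {e} → e ∈ B ∪ C → e ∈ A
      B∪C⊆A {e} e∈B∪C with x∈p∪q⁻ B C e∈B∪C
      ... | inj₁ e∈B = proj₂ (isA e)
                         (from (activeInG⇔ e) (proj₂ (to (activeInG₁•FS⇔ e) (proj₁ (isB e) e∈B))))
      ... | inj₂ e∈C = proj₂ (isA e) (proj₂ (to (activeInG₂S⇔ e) (proj₁ (isC e) e∈C)))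

    B-C-disjoint : Disjoint B C
    B-C-disjoint {e} e∈B e∈C =
      disjoint e (proj₁ (proj₁ (proj₁ (isB e) e∈B))) (proj₁ (proj₁ (proj₁ (isC e) e∈C)))

-- ea_{ω,G}(T) = ea_{ω,G₁•Fˢ}(T•Fˢ) + ea_{ω,G₂ˢ}(Fˢ).
corollary3p1 : ∀ {c ℓ₁ ℓ₂ : Level} (O : StrictTotalOrder c ℓ₁ ℓ₂) {n m : ℕ}
    (ends : Ends n m) (ω : Fin m → StrictTotalOrder.Carrier O) →
    Connected ends AllEdges →
    (∀ e f → StrictTotalOrder._≈_ O (ω e) (ω f) → e ≡ f) →
    (T : Subset m) → IsSpanningTree ends T →
    (E₁ E₂ : Subset m) →
    (∀ e → e ∈ E₁ ⊎ e ∈ E₂) → (∀ e → e ∈ E₁ → e ∈ E₂ → ⊥) →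
    (∀ e₁ e₂ → e₁ ∈ E₁ → e₂ ∈ E₂ → StrictTotalOrder._<_ O (ω e₁) (ω e₂)) →
    (S : Subset n) → Σ (Fin n) (λ v → v ∉ S) →
    (∀ v → v ∈ S → ∀ e → e ∈ E₂ → proj₁ (ends e) ≡ v → ⊥) →
    (∀ v → v ∈ S → ∀ e → e ∈ E₂ → proj₂ (ends e) ≡ v → ⊥) →
    let FS = DelVerts ends (λ e → e ∈ T × e ∈ E₂) S
        G₂S = DelVerts ends ⟦ E₂ ⟧ S
    in
    (A B C : Subset m) →
    IsEASet O ends ω _≡_ AllEdges ⟦ T ⟧ A →
    IsEASet O ends ω (ContrRel ends FS) (ContrEdges ⟦ E₁ ⟧ FS) (ContrEdges ⟦ T ⟧ FS) B →
    IsEASet O ends ω _≡_ G₂S FS C →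
    ∣ A ∣ ≡ ∣ B ∣ + ∣ C ∣
corollary3p1 O ends ω _ _ T (_ , acyclic) E₁ E₂ cover disjoint E₁<E₂ S _ isolated₁ isolated₂
             A B C isA isB isC =
  begin
    ∣ A ∣         ≡⟨ cong ∣_∣ (A≡B∪C A B C isA isB isC) ⟩
    ∣ B ∪ C ∣     ≡⟨ ∣p∪q∣≡∣p∣+∣q∣ B C (B-C-disjoint A B C isA isB isC) ⟩
    ∣ B ∣ + ∣ C ∣ ∎
  where
  open ≡-Reasoning
  open Corollary O ends ω T acyclic E₁ E₂ cover disjoint E₁<E₂ S isolated₁ isolated₂
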